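{- Let $G$ be a graph and $xy$ an edge of $G$ that lies on no triangle of $G$. If a phylogeny digraph $D$ for $G$ contains the arc $(x,y)$, then $x$ is the only in-neighbor of $y$ in $D$ that belongs to $V(G)$.
   Context: Graphs are finite and simple. For an acyclic digraph $D$, $P(D)$ is the graph on $V(D)$ with $uv$ an edge iff $(u,v)\in A(D)$ or $(v,u)\in A(D)$ or $u,v$ have a common out-neighbor in $D$. A phylogeny digraph for $G$ is an acyclic digraph $D$ with $G$ an induced subgraph of $P(D)$ and no arcs from $V(D)\setminus V(G)$ to $V(G)$. -}

module Defs where

open import Data.Nat using (ℕ)
open import Data.Fin using (Fin)
open import Data.Product using (Σ; ∃; _×_)
open import Data.Sum using (_⊎_)
open import Data.Empty using (⊥)
open import Relation.Nullary using (¬_)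
open import Relation.Binary.PropositionalEquality using (_≡_; _≢_)
open import Relation.Binary.Construct.Closure.Transitive using (TransClosure)
open import Function.Definitions using (Injective)
open import Function.Bundles using (_⇔_)

record Graph (m : ℕ) : Set₁ where
  field
    Adj   : Fin m → Fin m → Set
    sym   : ∀ {u v} → Adj u v → Adj v u
    irrefl : ∀ {u} → ¬ Adj u u

Digraph : ℕ → Set₁
Digraph n = Fin n → Fin n → Set

Acyclic : ∀ {n} → Digraph n → Set
Acyclic {n} A = ∀ (v : Fin n) → ¬ TransClosure A v v

PAdj : ∀ {n} → Digraph n → Fin n → Fin n → Set
PAdj {n} A u v = u ≢ v × (A u v ⊎ A v u ⊎ ∃ λ (w : Fin n) → A u w × A v w)

-- D (on Fin n) is a phylogeny digraph for G (on Fin m), where V(G) sits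
-- inside V(D) via the injection ι.
record IsPhylogenyDigraph {m n : ℕ} (G : Graph m) (A : Digraph n)
                          (ι : Fin m → Fin n) : Set where
  field
    acyclic   : Acyclic A
    injective : Injective _≡_ _≡_ ι
    induced   : ∀ (x y : Fin m) → Graph.Adj G x y ⇔ PAdj A (ι x) (ι y)
    noInArcsFromOutside : ∀ (u : Fin n) (x : Fin m) → A u (ι x) →
                          ∃ λ (x' : Fin m) → ι x' ≡ u

-- Let D be a phylogeny digraph for G containing the arc (x,y),
-- where the edge xy lies on no triangle of G, and let z ∈ V(G) be another
-- in-neighbour of y in D.  Since D is acyclic it has no loops, so z ≠ y.
-- If z ≠ x, then in P(D) the vertex z is adjacent to y (through the arc
-- (z,y)) and to x (y is a common out-neighbour of x and z).  As G is an
-- induced subgraph of P(D), both xz and yz are edges of G, so x, y, z form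
-- a triangle containing xy — a contradiction.  Hence z = x.
module Submission where

open import Defs
open import Data.Nat using (ℕ)
open import Data.Fin using (Fin; _≟_)
open import Data.Product using (∃; _×_; _,_)
open import Data.Sum using (inj₁; inj₂)
open import Data.Empty using (⊥-elim)
open import Relation.Nullary using (¬_; yes; no)
open import Relation.Binary.PropositionalEquality using (_≡_; _≢_; refl; ≢-sym)
open import Relation.Binary.Construct.Closure.Transitive using ([_])
open import Function.Bundles using (Equivalence)

acyclic⇒loopless : ∀ {n} {A : Digraph n} → Acyclic A → ∀ v → ¬ A v v
acyclic⇒loopless acyclic v loop = acyclic v [ loop ]

module _ {m n : ℕ} {G : Graph m} {A : Digraph n} {ι : Fin m → Fin n}
         (P : IsPhylogenyDigraph G A ι) where
  open IsPhylogenyDigraph P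

  embedding-preserves-≢ : ∀ {u v} → u ≢ v → ι u ≢ ι v
  embedding-preserves-≢ u≢v ιu≡ιv = u≢v (injective ιu≡ιv)

  arc⇒edge : ∀ {u v} → u ≢ v → A (ι u) (ι v) → Graph.Adj G v u
  arc⇒edge {u} {v} u≢v arc =
    Equivalence.from (induced v u)
      (embedding-preserves-≢ (≢-sym u≢v) , inj₂ (inj₁ arc))

  commonOutNeighbour⇒edge : ∀ {u v} w → u ≢ v →
                            A (ι u) w → A (ι v) w → Graph.Adj G u v
  commonOutNeighbour⇒edge {u} {v} w u≢v uw vw =
    Equivalence.from (induced u v)
      (embedding-preserves-≢ u≢v , inj₂ (inj₂ (w , uw , vw)))

  inNeighbour-≢ : ∀ {z y} → A (ι z) (ι y) → z ≢ y
  inNeighbour-≢ {z} loop refl = acyclic⇒loopless acyclic (ι z) loop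

lemma5 : ∀ {m n : ℕ} (G : Graph m) (A : Digraph n) (ι : Fin m → Fin n)
    (x y : Fin m) →
    Graph.Adj G x y →
    ¬ (∃ λ (z : Fin m) → Graph.Adj G x z × Graph.Adj G y z) →
    IsPhylogenyDigraph G A ι →
    A (ι x) (ι y) →
    ∀ (z : Fin m) → A (ι z) (ι y) → z ≡ x
lemma5 G A ι x y _ noTriangle P xy z zy with z ≟ x
... | yes z≡x = z≡x
... | no z≢x = ⊥-elim (noTriangle (z , xz , yz))
  where
    xz : Graph.Adj G x z
    xz = commonOutNeighbour⇒edge P (ι y) (≢-sym z≢x) xy zy
    yz : Graph.Adj G y z
    yz = arc⇒edge P (inNeighbour-≢ P zy) zy
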